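{- Let $t,n$ be integers. Then: (i) the restriction of $\phi_*$ to $X_{t,n}$ is an injective map $X_{t,n}\to Y_t$; (ii) left multiplication by $\Delta^2$ induces a bijection $X_{t,n}\to X_{ -t,n+6}$, left multiplication by $-I=\phi(\Delta^2)$ induces a bijection $Y_t\to Y_{ -t}$, and these bijections are compatible with $\phi_*$ (i.e. $\phi_*(\Delta^2c)=-\phi_*(c)$ for $c\in X_{t,n}$); (iii) left multiplication by $\Delta^4$ induces a bijection $X_{t,n}\to X_{t,n+12}$ compatible with $\phi_*$ (i.e. $\phi_*(\Delta^4 c)=\phi_*(c)$); (iv) the restriction of $\phi_*$ to the disjoint union $\coprod_{j=0}^{11}X_{t,n+j}$ is a bijection onto $Y_t$.
   Context: $B_3=\langle\sigma_1,\sigma_2:\sigma_1\sigma_2\sigma_1=\sigma_2\sigma_1\sigma_2\rangle$, $\Delta=\sigma_1\sigma_2\sigma_1$. Let $\phi:B_3\to\mathrm{SL}_2(\mathbb{Z})$ be the surjective homomorphism with $\phi(\sigma_1)=\begin{bmatrix}1&1\\0&1\end{bmatrix}$, $\phi(\sigma_2)=\begin{bmatrix}1&0\\-1&1\end{bmatrix}$, and $\epsilon:B_3\to\mathbb{Z}$ the exponent-sum homomorphism with $\epsilon(\sigma_1)=\epsilon(\sigma_2)=1$. The trace of $g\in B_3$ is $\mathrm{tr}(g):=\mathrm{tr}(\phi(g))$; trace and exponent sum are constant on conjugacy classes. $\phi_*$ is the map from conjugacy classes of $B_3$ to conjugacy classes of $\mathrm{SL}_2(\mathbb{Z})$ induced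 by $\phi$. $X_{t,n}$ is the set of conjugacy classes of $B_3$ of trace $t$ and exponent sum $n$; $Y_t$ is the set of conjugacy classes of $\mathrm{SL}_2(\mathbb{Z})$ of trace $t$. For a conjugacy class $c$ and a central element $z$, $zc=\{zg:g\in c\}$. -}

module Defs where

open import Data.Integer using (ℤ; +_; -_; _+_; _*_; _-_)
open import Data.List using (List; []; _∷_; _++_; reverse; map; foldr)
open import Data.Product using (Σ; ∃; _×_; _,_)
open import Data.Fin using (Fin; toℕ)
open import Relation.Binary.PropositionalEquality using (_≡_)

-- The braid group B₃ = ⟨σ₁, σ₂ ∣ σ₁σ₂σ₁ = σ₂σ₁σ₂⟩, presented by words in
-- the generators and their inverses modulo the group congruence.

data Letter : Set where
  σ₁ σ₂ σ₁⁻¹ σ₂⁻¹ : Letter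

invL : Letter → Letter
invL σ₁ = σ₁⁻¹
invL σ₂ = σ₂⁻¹
invL σ₁⁻¹ = σ₁
invL σ₂⁻¹ = σ₂

Word : Set
Word = List Letter

invW : Word → Word
invW w = reverse (map invL w)

data _≈B_ : Word → Word → Set where
  ≈refl  : ∀ {w} → w ≈B w
  ≈sym   : ∀ {w w'} → w ≈B w' → w' ≈B w
  ≈trans : ∀ {u v w} → u ≈B v → v ≈B w → u ≈B w
  cancel : ∀ u v x → (u ++ x ∷ invL x ∷ v) ≈B (u ++ v)
  braid  : ∀ u v → (u ++ σ₁ ∷ σ₂ ∷ σ₁ ∷ v) ≈B (u ++ σ₂ ∷ σ₁ ∷ σ₂ ∷ v)

ConjB : Word → Word → Set
ConjB w w' = ∃ λ u → (u ++ w ++ invW u) ≈B w'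

Δ : Word
Δ = σ₁ ∷ σ₂ ∷ σ₁ ∷ []

Δ² : Word
Δ² = Δ ++ Δ

Δ⁴ : Word
Δ⁴ = Δ² ++ Δ²

record Mat : Set where
  constructor mat
  field
    a b c d : ℤ

open Mat public

_⊗_ : Mat → Mat → Mat
mat a₁ b₁ c₁ d₁ ⊗ mat a₂ b₂ c₂ d₂ =
  mat (a₁ * a₂ + b₁ * c₂) (a₁ * b₂ + b₁ * d₂)
      (c₁ * a₂ + d₁ * c₂) (c₁ * b₂ + d₁ * d₂)

I₂ : Mat
I₂ = mat (+ 1) (+ 0) (+ 0) (+ 1)

-I₂ : Mat
-I₂ = mat (- + 1) (+ 0) (+ 0) (- + 1)

det : Mat → ℤ
det (mat a b c d) = a * d - b * c

trM : Mat → ℤ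
trM (mat a b c d) = a + d

InSL : Mat → Set
InSL M = det M ≡ + 1

invSL : Mat → Mat
invSL (mat a b c d) = mat d (- b) (- c) a

ConjSL : Mat → Mat → Set
ConjSL A B = ∃ λ P → InSL P × ((P ⊗ A) ⊗ invSL P ≡ B)

φL : Letter → Mat
φL σ₁ = mat (+ 1) (+ 1) (+ 0) (+ 1)
φL σ₂ = mat (+ 1) (+ 0) (- + 1) (+ 1)
φL σ₁⁻¹ = mat (+ 1) (- + 1) (+ 0) (+ 1)
φL σ₂⁻¹ = mat (+ 1) (+ 0) (+ 1) (+ 1)

φ : Word → Mat
φ = foldr (λ x M → φL x ⊗ M) I₂

εL : Letter → ℤ
εL σ₁ = + 1
εL σ₂ = + 1
εL σ₁⁻¹ = - + 1
εL σ₂⁻¹ = - + 1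

ε : Word → ℤ
ε = foldr (λ x k → εL x + k) (+ 0)

tr : Word → ℤ
tr w = trM (φ w)

InX : ℤ → ℤ → Word → Set
InX t n w = tr w ≡ t × ε w ≡ n

InY : ℤ → Mat → Set
InY t A = InSL A × trM A ≡ t

-- Maps between sets of equivalence classes, given by representatives.
-- Carrier A with "membership" P and equivalence R; carrier B with Q, S.

module _ {A B : Set} (P : A → Set) (R : A → A → Set)
                     (Q : B → Set) (S : B → B → Set) (f : A → B) where

  InducesMap : Set
  InducesMap = (∀ x → P x → Q (f x))
             × (∀ x y → P x → P y → R x y → S (f x) (f y))

  InjectiveOn : Set
  InjectiveOn = ∀ x y → P x → P y → S (f x) (f y) → R x y

  SurjectiveOn : Set
  SurjectiveOn = ∀ z → Q z → ∃ λ x → P x × S (f x) z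

  InducesInjection : Set
  InducesInjection = InducesMap × InjectiveOn

  InducesBijection : Set
  InducesBijection = InducesMap × InjectiveOn × SurjectiveOn

-- The disjoint union ∐_{j=0}^{11} X_{t,n+j}: pairs (j , w)

InXU : ℤ → ℤ → Σ (Fin 12) (λ _ → Word) → Set
InXU t n (j , w) = InX t (n + + toℕ j) w

ConjU : Σ (Fin 12) (λ _ → Word) → Σ (Fin 12) (λ _ → Word) → Set
ConjU (j , w) (j' , w') = j ≡ j' × ConjB w w'

φU : Σ (Fin 12) (λ _ → Word) → Mat
φU (j , w) = φ w

{-# OPTIONS --safe #-}
module Submission where

-- With Δ = σ₁σ₂σ₁ and Y = σ₁σ₂ one has B₃ = ⟨Δ, Y ∣ Δ² = Y³⟩ with Δ² central, so every braid
-- equals Δ^{2k} times a reduced word whose syllables alternate between Δ and Y^{±1}.  With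
-- X = φ(Δ) = [0 1; −1 0] one has X φ(Y) = −U and X φ(Y⁻¹) = L, and left multiplication by
-- U = [1 −1; 0 1] or L = [1 0; −1 1] preserves the matrices of sign pattern [+ −; − +] and
-- entry sum ≥ 3.  This ping-pong shows that no nonempty reduced word maps to ±I, while
-- φ(Δ²) = −I; hence ker φ = ⟨Δ⁴⟩, and as ε(Δ⁴) = 12 the pair (φ, ε) is injective on B₃.
-- Since φ is onto (Euclid's algorithm on the lower-left entry), braids whose images are
-- conjugate are conjugate exactly when their exponent sums agree, and their exponent sums
-- always agree modulo 12: this is (i) and (iv).  Parts (ii) and (iii) only use that Δ² is
-- central with φ(Δ²) = −I.

open import Defs
open import Data.Integer using (ℤ; +_; -_; _+_; _*_; _-_; -[1+_]; ∣_∣; NonZero)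
open import Data.Integer.DivMod using (_/_; a≡a%n+[a/n]*n; n%d<d) renaming (_%_ to _%ℤ_)
import Data.Integer.Properties as ℤ
open import Data.Integer.Tactic.RingSolver using (solve-∀)
open import Data.List using (List; []; _∷_; _++_; map; [_]; concatMap; foldr)
open import Data.List.Relation.Unary.Linked as Linked using (Linked; []; [-]; _∷_)
open import Data.List.Properties using (++-assoc; ++-identityʳ; unfold-reverse)
open import Data.Fin using (Fin; toℕ; fromℕ<)
open import Data.Fin.Properties using (toℕ-injective; toℕ<n; toℕ-fromℕ<)
open import Data.Product using (∃; _×_; _,_; map₂)
open import Data.Sum using (_⊎_; inj₁; inj₂)
open import Data.Empty using (⊥-elim)
open import Relation.Nullary using (¬_)
open import Data.Nat as ℕ using (ℕ; zero; suc; _≤_; s≤s; z≤n)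
open import Data.Nat.Induction using (<-rec)
open import Data.Nat.DivMod using (_%_; m≤n⇒m%n≡m; [m+kn]%n≡m%n)
import Data.Nat.Properties as ℕP
open import Level using (0ℓ)
open import Relation.Binary.Bundles using (Setoid)
import Relation.Binary.Reasoning.Setoid as SetoidReasoning
open import Relation.Binary.PropositionalEquality hiding ([_])

-- SL₂(ℤ)

mat-cong : ∀ {a b c d a′ b′ c′ d′} →
           a ≡ a′ → b ≡ b′ → c ≡ c′ → d ≡ d′ → mat a b c d ≡ mat a′ b′ c′ d′
mat-cong refl refl refl refl = refl

⊗-assoc : ∀ A B C → (A ⊗ B) ⊗ C ≡ A ⊗ (B ⊗ C)
⊗-assoc (mat a b c d) (mat a′ b′ c′ d′) (mat a″ b″ c″ d″) =
  mat-cong (entry a b a′ b′ c′ d′ a″ c″) (entry a b a′ b′ c′ d′ b″ d″)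
           (entry c d a′ b′ c′ d′ a″ c″) (entry c d a′ b′ c′ d′ b″ d″)
  where
  entry : ∀ x y a′ b′ c′ d′ z w → (x * a′ + y * c′) * z + (x * b′ + y * d′) * w
                                ≡ x * (a′ * z + b′ * w) + y * (c′ * z + d′ * w)
  entry = solve-∀

⊗-identityˡ : ∀ M → I₂ ⊗ M ≡ M
⊗-identityˡ (mat a b c d) = mat-cong (top a c) (top b d) (bottom a c) (bottom b d)
  where
  top : ∀ x y → + 1 * x + + 0 * y ≡ x
  top = solve-∀
  bottom : ∀ x y → + 0 * x + + 1 * y ≡ y
  bottom = solve-∀

⊗-identityʳ : ∀ M → M ⊗ I₂ ≡ M
⊗-identityʳ (mat a b c d) = mat-cong (left a b) (right a b) (left c d) (right c d)
  where
  left : ∀ x y → x * + 1 + y * + 0 ≡ x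
  left = solve-∀
  right : ∀ x y → x * + 0 + y * + 1 ≡ y
  right = solve-∀

det-⊗ : ∀ A B → det (A ⊗ B) ≡ det A * det B
det-⊗ (mat a b c d) (mat a′ b′ c′ d′) = cauchy-binet a b c d a′ b′ c′ d′
  where
  cauchy-binet : ∀ a b c d a′ b′ c′ d′ →
    (a * a′ + b * c′) * (c * b′ + d * d′) - (a * b′ + b * d′) * (c * a′ + d * c′)
    ≡ (a * d - b * c) * (a′ * d′ - b′ * c′)
  cauchy-binet = solve-∀

InSL-⊗ : ∀ A B → InSL A → InSL B → InSL (A ⊗ B)
InSL-⊗ A B detA≡1 detB≡1 = trans (det-⊗ A B) (cong₂ _*_ detA≡1 detB≡1)

invSL-⊗ : ∀ A B → invSL (A ⊗ B) ≡ invSL B ⊗ invSL A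
invSL-⊗ (mat a b c d) (mat a′ b′ c′ d′) =
  mat-cong (e₁ b′ c d d′) (e₂ a b b′ d′) (e₃ c d a′ c′) (e₄ a b a′ c′)
  where
  e₁ : ∀ x y z w → y * x + z * w ≡ w * z + (- x) * (- y)
  e₁ = solve-∀
  e₂ : ∀ x y z w → - (x * z + y * w) ≡ w * (- y) + (- z) * x
  e₂ = solve-∀
  e₃ : ∀ x y z w → - (x * z + y * w) ≡ (- w) * y + z * (- x)
  e₃ = solve-∀
  e₄ : ∀ x y z w → x * z + y * w ≡ (- w) * (- y) + z * x
  e₄ = solve-∀

⊗-invSLʳ : ∀ A → InSL A → A ⊗ invSL A ≡ I₂
⊗-invSLʳ (mat a b c d) detA≡1 =
  mat-cong (trans (d₁₁ a b c d) detA≡1) (off₁ a b) (off₂ c d) (trans (d₂₂ a b c d) detA≡1)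
  where
  d₁₁ : ∀ a b c d → a * d + b * (- c) ≡ a * d - b * c
  d₁₁ = solve-∀
  d₂₂ : ∀ a b c d → c * (- b) + d * a ≡ a * d - b * c
  d₂₂ = solve-∀
  off₁ : ∀ x y → x * (- y) + y * x ≡ + 0
  off₁ = solve-∀
  off₂ : ∀ x y → x * y + y * (- x) ≡ + 0
  off₂ = solve-∀

-I₂-commutes : ∀ A B → A ⊗ (-I₂ ⊗ B) ≡ -I₂ ⊗ (A ⊗ B)
-I₂-commutes (mat a b c d) (mat a′ b′ c′ d′) =
  mat-cong (top a b c d a′ c′) (top a b c d b′ d′) (bottom c d a b a′ c′) (bottom c d a b b′ d′)
  where
  top : ∀ x y u v p q → x * (- + 1 * p + + 0 * q) + y * (+ 0 * p + - + 1 * q)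
                      ≡ - + 1 * (x * p + y * q) + + 0 * (u * p + v * q)
  top = solve-∀
  bottom : ∀ x y u v p q → x * (- + 1 * p + + 0 * q) + y * (+ 0 * p + - + 1 * q)
                         ≡ + 0 * (u * p + v * q) + - + 1 * (x * p + y * q)
  bottom = solve-∀

-I₂-involutive : ∀ A → -I₂ ⊗ (-I₂ ⊗ A) ≡ A
-I₂-involutive (mat a b c d) = mat-cong (top a c) (top b d) (bottom a c) (bottom b d)
  where
  top : ∀ x y → - + 1 * (- + 1 * x + + 0 * y) + + 0 * (+ 0 * x + - + 1 * y) ≡ x
  top = solve-∀
  bottom : ∀ x y → + 0 * (- + 1 * x + + 0 * y) + - + 1 * (+ 0 * x + - + 1 * y) ≡ y
  bottom = solve-∀

det-neg : ∀ A → det (-I₂ ⊗ A) ≡ det A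
det-neg (mat a b c d) = expand a b c d
  where
  expand : ∀ a b c d → (- + 1 * a + + 0 * c) * (+ 0 * b + - + 1 * d)
                       - (- + 1 * b + + 0 * d) * (+ 0 * a + - + 1 * c) ≡ a * d - b * c
  expand = solve-∀

trM-neg : ∀ A → trM (-I₂ ⊗ A) ≡ - trM A
trM-neg (mat a b c d) = expand a b c d
  where
  expand : ∀ a b c d → - + 1 * a + + 0 * c + (+ 0 * b + - + 1 * d) ≡ - (a + d)
  expand = solve-∀

≡⇒ConjSL : ∀ {A B} → A ≡ B → ConjSL A B
≡⇒ConjSL {A} refl = I₂ , refl , trans (⊗-identityʳ (I₂ ⊗ A)) (⊗-identityˡ A)

ConjSL-neg : ∀ {A B} → ConjSL A B → ConjSL (-I₂ ⊗ A) (-I₂ ⊗ B)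
ConjSL-neg {A} (P , P-InSL , PAP⁻¹≡B) =
  P , P-InSL ,
  trans (cong (_⊗ invSL P) (-I₂-commutes P A)) (trans (⊗-assoc -I₂ (P ⊗ A) (invSL P)) (cong (-I₂ ⊗_) PAP⁻¹≡B))

infixr 30 _^ᴹ_
_^ᴹ_ : Mat → ℕ → Mat
M ^ᴹ zero = I₂
M ^ᴹ suc n = M ⊗ M ^ᴹ n

^ᴹ-+ : ∀ M p m → M ^ᴹ p ⊗ M ^ᴹ m ≡ M ^ᴹ (p ℕ.+ m)
^ᴹ-+ M zero m = ⊗-identityˡ (M ^ᴹ m)
^ᴹ-+ M (suc p) m = trans (⊗-assoc M (M ^ᴹ p) (M ^ᴹ m)) (cong (M ⊗_) (^ᴹ-+ M p m))

I₂^ᴹ : ∀ n → I₂ ^ᴹ n ≡ I₂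
I₂^ᴹ zero = refl
I₂^ᴹ (suc n) = trans (⊗-identityˡ (I₂ ^ᴹ n)) (I₂^ᴹ n)

T : ℤ → Mat
T k = mat (+ 1) k (+ 0) (+ 1)

T-+ : ∀ k l → T k ⊗ T l ≡ T (k + l)
T-+ k l = mat-cong (diagonal k) (expand k l) refl refl
  where
  diagonal : ∀ k → + 1 * + 1 + k * + 0 ≡ + 1
  diagonal = solve-∀
  expand : ∀ k l → + 1 * l + k * + 1 ≡ k + l
  expand = solve-∀

T-^ᴹ : ∀ k n → T k ^ᴹ n ≡ T (+ n * k)
T-^ᴹ k zero = refl
T-^ᴹ k (suc n) = trans (cong (T k ⊗_) (T-^ᴹ k n)) (trans (T-+ k (+ n * k)) (cong T (expand (+ n) k)))
  where
  expand : ∀ n k → k + n * k ≡ (+ 1 + n) * k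
  expand = solve-∀

T-InSL : ∀ k → InSL (T k)
T-InSL k = expand k
  where
  expand : ∀ k → + 1 * + 1 - k * + 0 ≡ + 1
  expand = solve-∀

-- Words modulo the braid relations

≈B-setoid : Setoid 0ℓ 0ℓ
≈B-setoid = record
  { Carrier = Word
  ; _≈_ = _≈B_
  ; isEquivalence = record { refl = ≈refl ; sym = ≈sym ; trans = ≈trans }
  }

module ≈B-Reasoning = SetoidReasoning ≈B-setoid

infixr 4 _∙_
_∙_ : ∀ {u v w} → u ≈B v → v ≈B w → u ≈B w
_∙_ = ≈trans

≡⇒≈B : ∀ {u v} → u ≡ v → u ≈B v
≡⇒≈B refl = ≈refl

++-reassoc : ∀ (p u r q : Word) → p ++ (u ++ r) ++ q ≡ (p ++ u) ++ (r ++ q)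
++-reassoc p u r q = trans (cong (p ++_) (++-assoc u r q)) (sym (++-assoc p u (r ++ q)))

≈B-cong : ∀ p q {a b} → a ≈B b → (p ++ a ++ q) ≈B (p ++ b ++ q)
≈B-cong p q ≈refl = ≈refl
≈B-cong p q (≈sym a≈b) = ≈sym (≈B-cong p q a≈b)
≈B-cong p q (≈trans a≈b b≈c) = ≈B-cong p q a≈b ∙ ≈B-cong p q b≈c
≈B-cong p q (cancel u v x) =
  ≡⇒≈B (++-reassoc p u _ q) ∙ cancel (p ++ u) (v ++ q) x ∙ ≡⇒≈B (sym (++-reassoc p u v q))
≈B-cong p q (braid u v) =
  ≡⇒≈B (++-reassoc p u _ q) ∙ braid (p ++ u) (v ++ q) ∙ ≡⇒≈B (sym (++-reassoc p u _ q))

≈B-congˡ : ∀ p {a b} → a ≈B b → (p ++ a) ≈B (p ++ b)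
≈B-congˡ p {a} {b} a≈b =
  ≡⇒≈B (cong (p ++_) (sym (++-identityʳ a))) ∙ ≈B-cong p [] a≈b ∙ ≡⇒≈B (cong (p ++_) (++-identityʳ b))

≈B-congʳ : ∀ q {a b} → a ≈B b → (a ++ q) ≈B (b ++ q)
≈B-congʳ = ≈B-cong []

invL-involutive : ∀ x → invL (invL x) ≡ x
invL-involutive σ₁ = refl
invL-involutive σ₂ = refl
invL-involutive σ₁⁻¹ = refl
invL-involutive σ₂⁻¹ = refl

invW-∷ : ∀ x u → invW (x ∷ u) ≡ invW u ++ [ invL x ]
invW-∷ x u = unfold-reverse (invL x) (map invL u)

cancel-inv : ∀ x q → (invL x ∷ x ∷ q) ≈B q
cancel-inv x q = subst (λ y → (invL x ∷ y ∷ q) ≈B q) (invL-involutive x) (cancel [] q (invL x))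

invW-cancelʳ : ∀ w q → (w ++ invW w ++ q) ≈B q
invW-cancelʳ [] q = ≈refl
invW-cancelʳ (x ∷ w) q =
  ≡⇒≈B (cong (λ r → x ∷ w ++ r) (trans (cong (_++ q) (invW-∷ x w)) (++-assoc (invW w) [ invL x ] q)))
  ∙ ≈B-congˡ [ x ] (invW-cancelʳ w (invL x ∷ q))
  ∙ cancel [] q x

invW-cancelˡ : ∀ w q → (invW w ++ w ++ q) ≈B q
invW-cancelˡ [] q = ≈refl
invW-cancelˡ (x ∷ w) q =
  ≡⇒≈B (trans (cong (_++ x ∷ w ++ q) (invW-∷ x w)) (++-assoc (invW w) [ invL x ] (x ∷ w ++ q)))
  ∙ ≈B-congˡ (invW w) (cancel-inv x (w ++ q))
  ∙ invW-cancelˡ w q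

infixr 8 _^_
_^_ : Word → ℕ → Word
c ^ zero = []
c ^ suc n = c ++ c ^ n

infixr 8 _^ℤ_
_^ℤ_ : Word → ℤ → Word
c ^ℤ + n = c ^ n
c ^ℤ -[1+ n ] = invW c ^ suc n

-- The homomorphisms φ and ε

φ-++ : ∀ u v → φ (u ++ v) ≡ φ u ⊗ φ v
φ-++ [] v = sym (⊗-identityˡ (φ v))
φ-++ (x ∷ u) v = trans (cong (φL x ⊗_) (φ-++ u v)) (sym (⊗-assoc (φL x) (φ u) (φ v)))

ε-++ : ∀ u v → ε (u ++ v) ≡ ε u + ε v
ε-++ [] v = sym (ℤ.+-identityˡ (ε v))
ε-++ (x ∷ u) v = trans (cong (λ k → εL x + k) (ε-++ u v)) (sym (ℤ.+-assoc (εL x) (ε u) (ε v)))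

φ-splice : ∀ u v {a b} → φ a ≡ φ b → φ (u ++ a ++ v) ≡ φ (u ++ b ++ v)
φ-splice u v {a} {b} φa≡φb = begin
  φ (u ++ a ++ v)     ≡⟨ φ-++ u (a ++ v) ⟩
  φ u ⊗ φ (a ++ v)    ≡⟨ cong (φ u ⊗_) (φ-++ a v) ⟩
  φ u ⊗ (φ a ⊗ φ v)   ≡⟨ cong (λ M → φ u ⊗ (M ⊗ φ v)) φa≡φb ⟩
  φ u ⊗ (φ b ⊗ φ v)   ≡⟨ cong (φ u ⊗_) (φ-++ b v) ⟨
  φ u ⊗ φ (b ++ v)    ≡⟨ φ-++ u (b ++ v) ⟨
  φ (u ++ b ++ v)     ∎
  where open ≡-Reasoning

ε-splice : ∀ u v {a b} → ε a ≡ ε b → ε (u ++ a ++ v) ≡ ε (u ++ b ++ v)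
ε-splice u v {a} {b} εa≡εb = begin
  ε (u ++ a ++ v)     ≡⟨ ε-++ u (a ++ v) ⟩
  ε u + ε (a ++ v)    ≡⟨ cong (λ k → ε u + k) (ε-++ a v) ⟩
  ε u + (ε a + ε v)   ≡⟨ cong (λ k → ε u + (k + ε v)) εa≡εb ⟩
  ε u + (ε b + ε v)   ≡⟨ cong (λ k → ε u + k) (ε-++ b v) ⟨
  ε u + ε (b ++ v)    ≡⟨ ε-++ u (b ++ v) ⟨
  ε (u ++ b ++ v)     ∎
  where open ≡-Reasoning

φ-cancel : ∀ x → φ (x ∷ invL x ∷ []) ≡ I₂
φ-cancel σ₁ = refl
φ-cancel σ₂ = refl
φ-cancel σ₁⁻¹ = refl
φ-cancel σ₂⁻¹ = refl

ε-cancel : ∀ x → ε (x ∷ invL x ∷ []) ≡ + 0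
ε-cancel σ₁ = refl
ε-cancel σ₂ = refl
ε-cancel σ₁⁻¹ = refl
ε-cancel σ₂⁻¹ = refl

φ-resp-≈B : ∀ {w w′} → w ≈B w′ → φ w ≡ φ w′
φ-resp-≈B ≈refl = refl
φ-resp-≈B (≈sym p) = sym (φ-resp-≈B p)
φ-resp-≈B (≈trans p q) = trans (φ-resp-≈B p) (φ-resp-≈B q)
φ-resp-≈B (cancel u v x) = φ-splice u v {x ∷ invL x ∷ []} {[]} (φ-cancel x)
φ-resp-≈B (braid u v) = φ-splice u v {Δ} {σ₂ ∷ σ₁ ∷ σ₂ ∷ []} refl

ε-resp-≈B : ∀ {w w′} → w ≈B w′ → ε w ≡ ε w′
ε-resp-≈B ≈refl = refl
ε-resp-≈B (≈sym p) = sym (ε-resp-≈B p)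
ε-resp-≈B (≈trans p q) = trans (ε-resp-≈B p) (ε-resp-≈B q)
ε-resp-≈B (cancel u v x) = ε-splice u v {x ∷ invL x ∷ []} {[]} (ε-cancel x)
ε-resp-≈B (braid u v) = ε-splice u v {Δ} {σ₂ ∷ σ₁ ∷ σ₂ ∷ []} refl

φL-invL : ∀ x → φL (invL x) ≡ invSL (φL x)
φL-invL σ₁ = refl
φL-invL σ₂ = refl
φL-invL σ₁⁻¹ = refl
φL-invL σ₂⁻¹ = refl

φ-invW : ∀ u → φ (invW u) ≡ invSL (φ u)
φ-invW [] = refl
φ-invW (x ∷ u) = begin
  φ (invW (x ∷ u))                ≡⟨ cong φ (invW-∷ x u) ⟩
  φ (invW u ++ [ invL x ])        ≡⟨ φ-++ (invW u) [ invL x ] ⟩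
  φ (invW u) ⊗ (φL (invL x) ⊗ I₂) ≡⟨ cong₂ _⊗_ (φ-invW u) (trans (⊗-identityʳ _) (φL-invL x)) ⟩
  invSL (φ u) ⊗ invSL (φL x)      ≡⟨ invSL-⊗ (φL x) (φ u) ⟨
  invSL (φL x ⊗ φ u)              ∎
  where open ≡-Reasoning

ε-invW : ∀ u → ε (invW u) ≡ - ε u
ε-invW [] = refl
ε-invW (x ∷ u) = begin
  ε (invW (x ∷ u))               ≡⟨ cong ε (invW-∷ x u) ⟩
  ε (invW u ++ [ invL x ])       ≡⟨ ε-++ (invW u) [ invL x ] ⟩
  ε (invW u) + (εL (invL x) + + 0) ≡⟨ cong₂ _+_ (ε-invW u) (trans (ℤ.+-identityʳ _) (εL-invL x)) ⟩
  - ε u + - εL x                 ≡⟨ ℤ.+-comm (- ε u) (- εL x) ⟩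
  - εL x + - ε u                 ≡⟨ ℤ.neg-distrib-+ (εL x) (ε u) ⟨
  - (εL x + ε u)                 ∎
  where
  open ≡-Reasoning
  εL-invL : ∀ x → εL (invL x) ≡ - εL x
  εL-invL σ₁ = refl
  εL-invL σ₂ = refl
  εL-invL σ₁⁻¹ = refl
  εL-invL σ₂⁻¹ = refl

φ-InSL : ∀ w → InSL (φ w)
φ-InSL [] = refl
φ-InSL (x ∷ w) = trans (det-⊗ (φL x) (φ w)) (cong₂ _*_ (det-φL x) (φ-InSL w))
  where
  det-φL : ∀ x → det (φL x) ≡ + 1
  det-φL σ₁ = refl
  det-φL σ₂ = refl
  det-φL σ₁⁻¹ = refl
  det-φL σ₂⁻¹ = refl

φ-^ : ∀ c n → φ (c ^ n) ≡ φ c ^ᴹ n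
φ-^ c zero = refl
φ-^ c (suc n) = trans (φ-++ c (c ^ n)) (cong (φ c ⊗_) (φ-^ c n))

ε-^ : ∀ c n → ε (c ^ n) ≡ + n * ε c
ε-^ c zero = refl
ε-^ c (suc n) = trans (ε-++ c (c ^ n)) (trans (cong (λ k → ε c + k) (ε-^ c n)) (expand (+ n) (ε c)))
  where
  expand : ∀ n e → e + n * e ≡ (+ 1 + n) * e
  expand = solve-∀

ε-^ℤ : ∀ c k → ε (c ^ℤ k) ≡ k * ε c
ε-^ℤ c (+ n) = ε-^ c n
ε-^ℤ c -[1+ n ] = trans (ε-^ (invW c) (suc n)) (trans (cong (+ suc n *_) (ε-invW c)) (negate (+ suc n) (ε c)))
  where
  negate : ∀ n e → n * - e ≡ - n * e
  negate = solve-∀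

φ-^ℤ-I₂ : ∀ c k → φ c ≡ I₂ → φ (c ^ℤ k) ≡ I₂
φ-^ℤ-I₂ c (+ n) φc≡I₂ = trans (φ-^ c n) (trans (cong (_^ᴹ n) φc≡I₂) (I₂^ᴹ n))
φ-^ℤ-I₂ c -[1+ n ] φc≡I₂ =
  trans (φ-^ (invW c) (suc n)) (trans (cong (_^ᴹ suc n) φc⁻¹≡I₂) (I₂^ᴹ (suc n)))
  where
  φc⁻¹≡I₂ : φ (invW c) ≡ I₂
  φc⁻¹≡I₂ = trans (φ-invW c) (cong invSL φc≡I₂)

φ-σ₁^ℤ : ∀ k → φ ([ σ₁ ] ^ℤ k) ≡ T k
φ-σ₁^ℤ (+ n) = trans (φ-^ [ σ₁ ] n) (trans (T-^ᴹ (+ 1) n) (cong T (ℤ.*-identityʳ (+ n))))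
φ-σ₁^ℤ -[1+ n ] = trans (φ-^ [ σ₁⁻¹ ] (suc n)) (trans (T-^ᴹ (- + 1) (suc n)) (cong T (negate (+ suc n))))
  where
  negate : ∀ k → k * - + 1 ≡ - k
  negate = solve-∀

tr-shift : ∀ c w → φ c ≡ I₂ → tr (c ++ w) ≡ tr w
tr-shift c w φc≡I₂ = cong trM (trans (φ-++ c w) (trans (cong (_⊗ φ w) φc≡I₂) (⊗-identityˡ (φ w))))

tr-flip : ∀ c w → φ c ≡ -I₂ → tr (c ++ w) ≡ - tr w
tr-flip c w φc≡-I₂ = trans (cong trM (trans (φ-++ c w) (cong (_⊗ φ w) φc≡-I₂))) (trM-neg (φ w))

ε-shift : ∀ c w → ε (c ++ w) ≡ ε w + ε c
ε-shift c w = trans (ε-++ c w) (ℤ.+-comm (ε c) (ε w))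

ε-unshift : ∀ c w → ε (invW c ++ w) ≡ ε w - ε c
ε-unshift c w = trans (ε-++ (invW c) w) (trans (cong (_+ ε w) (ε-invW c)) (ℤ.+-comm (- ε c) (ε w)))

φ-conj : ∀ u w → φ (u ++ w ++ invW u) ≡ (φ u ⊗ φ w) ⊗ invSL (φ u)
φ-conj u w = begin
  φ (u ++ w ++ invW u)              ≡⟨ φ-++ u (w ++ invW u) ⟩
  φ u ⊗ φ (w ++ invW u)             ≡⟨ cong (φ u ⊗_) (trans (φ-++ w (invW u)) (cong (φ w ⊗_) (φ-invW u))) ⟩
  φ u ⊗ (φ w ⊗ invSL (φ u))         ≡⟨ ⊗-assoc (φ u) (φ w) (invSL (φ u)) ⟨
  (φ u ⊗ φ w) ⊗ invSL (φ u)         ∎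
  where open ≡-Reasoning

ε-conj : ∀ u w → ε (u ++ w ++ invW u) ≡ ε w
ε-conj u w = begin
  ε (u ++ w ++ invW u)        ≡⟨ ε-++ u (w ++ invW u) ⟩
  ε u + ε (w ++ invW u)       ≡⟨ cong (λ k → ε u + k) (trans (ε-++ w (invW u)) (cong (λ k → ε w + k) (ε-invW u))) ⟩
  ε u + (ε w + - ε u)         ≡⟨ cancel-outer (ε u) (ε w) ⟩
  ε w                         ∎
  where
  open ≡-Reasoning
  cancel-outer : ∀ e f → e + (f + - e) ≡ f
  cancel-outer = solve-∀

-- Central words

Commute : Word → Word → Set
Commute a c = (a ++ c) ≈B (c ++ a)

Central : Word → Set
Central c = ∀ w → Commute w c

commute-invL : ∀ x c → Commute [ x ] c → Commute [ invL x ] c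
commute-invL x c xc≈cx =
  ≡⇒≈B (cong (invL x ∷_) (sym (++-identityʳ c)))
  ∙ ≈sym (cancel (invL x ∷ c) [] x)
  ∙ ≡⇒≈B (cong (invL x ∷_) (sym (++-assoc c [ x ] [ invL x ])))
  ∙ ≈B-cong [ invL x ] [ invL x ] (≈sym xc≈cx)
  ∙ cancel-inv x (c ++ [ invL x ])

commute-invWʳ : ∀ a c → Commute a c → Commute a (invW c)
commute-invWʳ a c ac≈ca = begin
  a ++ invW c                              ≈⟨ invW-cancelˡ c (a ++ invW c) ⟨
  invW c ++ c ++ a ++ invW c               ≡⟨ cong (invW c ++_) (sym (++-assoc c a (invW c))) ⟩
  invW c ++ (c ++ a) ++ invW c             ≈⟨ ≈B-cong (invW c) (invW c) ac≈ca ⟨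
  invW c ++ (a ++ c) ++ invW c             ≡⟨ cong (invW c ++_) (++-assoc a c (invW c)) ⟩
  invW c ++ a ++ c ++ invW c               ≡⟨ cong (λ r → invW c ++ a ++ c ++ r) (++-identityʳ (invW c)) ⟨
  invW c ++ a ++ c ++ invW c ++ []         ≈⟨ ≈B-congˡ (invW c) (≈B-congˡ a (invW-cancelʳ c [])) ⟩
  invW c ++ a ++ []                        ≡⟨ cong (invW c ++_) (++-identityʳ a) ⟩
  invW c ++ a                              ∎
  where open ≈B-Reasoning

commute-++ʳ : ∀ a c c′ → Commute a c → Commute a c′ → Commute a (c ++ c′)
commute-++ʳ a c c′ ac≈ca ac′≈c′a =
  ≡⇒≈B (sym (++-assoc a c c′)) ∙ ≈B-congʳ c′ ac≈ca ∙ ≡⇒≈B (++-assoc c a c′)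
  ∙ ≈B-congˡ c ac′≈c′a ∙ ≡⇒≈B (sym (++-assoc c c′ a))

central-from-generators : ∀ c → Commute [ σ₁ ] c → Commute [ σ₂ ] c → Central c
central-from-generators c σ₁c≈cσ₁ σ₂c≈cσ₂ = go
  where
  letter : ∀ x → Commute [ x ] c
  letter σ₁ = σ₁c≈cσ₁
  letter σ₂ = σ₂c≈cσ₂
  letter σ₁⁻¹ = commute-invL σ₁ c σ₁c≈cσ₁
  letter σ₂⁻¹ = commute-invL σ₂ c σ₂c≈cσ₂
  go : Central c
  go [] = ≡⇒≈B (sym (++-identityʳ c))
  go (x ∷ w) = ≈B-congˡ [ x ] (go w) ∙ ≈B-congʳ w (letter x) ∙ ≡⇒≈B (++-assoc c [ x ] w)

Central-invW : ∀ {c} → Central c → Central (invW c)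
Central-invW {c} c-central w = commute-invWʳ w c (c-central w)

Central-++ : ∀ {c c′} → Central c → Central c′ → Central (c ++ c′)
Central-++ {c} {c′} c-central c′-central w = commute-++ʳ w c c′ (c-central w) (c′-central w)

Central-^ : ∀ {c} n → Central c → Central (c ^ n)
Central-^ zero c-central w = ≡⇒≈B (++-identityʳ w)
Central-^ (suc n) c-central = Central-++ c-central (Central-^ n c-central)

Δ²-central : Central Δ²
Δ²-central = central-from-generators Δ² σ₁Δ²≈Δ²σ₁ σ₂Δ²≈Δ²σ₂
  where
  σ₁Δ²≈Δ²σ₁ : Commute [ σ₁ ] Δ²
  σ₁Δ²≈Δ²σ₁ = braid [ σ₁ ] Δ ∙ ≈B-congˡ Δ (≈sym (braid [] [ σ₁ ]))
  σ₂Δ²≈Δ²σ₂ : Commute [ σ₂ ] Δ²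
  σ₂Δ²≈Δ²σ₂ = ≈sym (braid [] (σ₁ ∷ Δ)) ∙ ≈B-congˡ Δ (braid [ σ₁ ] [])

Δ⁴-central : Central Δ⁴
Δ⁴-central = Central-++ Δ²-central Δ²-central

Central-slide : ∀ {c} → Central c → ∀ u w → (u ++ c ++ w) ≈B (c ++ u ++ w)
Central-slide {c} c-central u w =
  ≡⇒≈B (sym (++-assoc u c w)) ∙ ≈B-congʳ w (c-central u) ∙ ≡⇒≈B (++-assoc c u w)

conj-central : ∀ {c} → Central c → ∀ u x → (u ++ (c ++ x) ++ invW u) ≈B (c ++ u ++ x ++ invW u)
conj-central {c} c-central u x =
  ≡⇒≈B (cong (u ++_) (++-assoc c x (invW u))) ∙ Central-slide c-central u (x ++ invW u)

Central-ConjB : ∀ {c} → Central c → ∀ {x y} → ConjB x y → ConjB (c ++ x) (c ++ y)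
Central-ConjB {c} c-central {x} (u , uxu⁻¹≈y) = u , (conj-central c-central u x ∙ ≈B-congˡ c uxu⁻¹≈y)

Central-ConjB⁻¹ : ∀ {c} → Central c → ∀ {x y} → ConjB (c ++ x) (c ++ y) → ConjB x y
Central-ConjB⁻¹ {c} c-central {x} {y} (u , conj≈cy) =
  u , (≈sym (invW-cancelˡ c _)
       ∙ ≈B-congˡ (invW c) (≈sym (conj-central c-central u x) ∙ conj≈cy)
       ∙ invW-cancelˡ c y)

central-translation-bijection : ∀ {c} {P Q : Word → Set} → Central c →
  (∀ w → P w → Q (c ++ w)) → (∀ w → Q w → P (invW c ++ w)) →
  InducesBijection P ConjB Q ConjB (c ++_)
central-translation-bijection {c} c-central forward backward =
  (forward , λ _ _ _ _ → Central-ConjB c-central) ,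
  (λ _ _ _ _ → Central-ConjB⁻¹ c-central) ,
  λ z Qz → invW c ++ z , backward z Qz , ([] , (≡⇒≈B (++-identityʳ _) ∙ invW-cancelʳ c z))

-- Normal forms

Y Y⁻¹ Δ⁻² : Word
Y = σ₁ ∷ σ₂ ∷ []
Y⁻¹ = invW Y
Δ⁻² = invW Δ²

Y³≈Δ² : ∀ q → (Y ++ Y ++ Y ++ q) ≈B (Δ² ++ q)
Y³≈Δ² q = ≈sym (braid Δ q)

Y²≈Δ²Y⁻¹ : ∀ q → (Y ++ Y ++ q) ≈B (Δ² ++ Y⁻¹ ++ q)
Y²≈Δ²Y⁻¹ q = ≈B-congˡ (Y ++ Y) (≈sym (invW-cancelʳ Y q)) ∙ Y³≈Δ² (Y⁻¹ ++ q)

Y⁻²≈Δ⁻²Y : ∀ q → (Y⁻¹ ++ Y⁻¹ ++ q) ≈B (Δ⁻² ++ Y ++ q)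
Y⁻²≈Δ⁻²Y q = begin
  Y⁻¹ ++ Y⁻¹ ++ q                           ≈⟨ invW-cancelˡ Δ² (Y⁻¹ ++ Y⁻¹ ++ q) ⟨
  Δ⁻² ++ Δ² ++ Y⁻¹ ++ Y⁻¹ ++ q              ≈⟨ ≈B-congˡ Δ⁻² (Y³≈Δ² (Y⁻¹ ++ Y⁻¹ ++ q)) ⟨
  Δ⁻² ++ Y ++ Y ++ Y ++ Y⁻¹ ++ Y⁻¹ ++ q     ≈⟨ ≈B-congˡ (Δ⁻² ++ Y ++ Y) (invW-cancelʳ Y (Y⁻¹ ++ q)) ⟩
  Δ⁻² ++ Y ++ Y ++ Y⁻¹ ++ q                 ≈⟨ ≈B-congˡ (Δ⁻² ++ Y) (invW-cancelʳ Y q) ⟩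
  Δ⁻² ++ Y ++ q                             ∎
  where open ≈B-Reasoning

σ₁≈Y⁻¹Δ : ∀ q → (σ₁ ∷ q) ≈B (Y⁻¹ ++ Δ ++ q)
σ₁≈Y⁻¹Δ q = ≈sym (cancel [ σ₂⁻¹ ] (σ₂ ∷ σ₁ ∷ q) σ₁⁻¹ ∙ cancel [] (σ₁ ∷ q) σ₂⁻¹)

σ₂≈ΔY⁻¹ : ∀ q → (σ₂ ∷ q) ≈B (Δ ++ Y⁻¹ ++ q)
σ₂≈ΔY⁻¹ q =
  ≈sym (braid [] (σ₂⁻¹ ∷ σ₁⁻¹ ∷ q) ∙ cancel (σ₂ ∷ σ₁ ∷ []) (σ₁⁻¹ ∷ q) σ₂ ∙ cancel [ σ₂ ] q σ₁)

σ₁⁻¹≈Δ⁻²ΔY : ∀ q → (σ₁⁻¹ ∷ q) ≈B (Δ⁻² ++ Δ ++ Y ++ q)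
σ₁⁻¹≈Δ⁻²ΔY q =
  ≈sym (≈B-congˡ Δ⁻² (≈sym (cancel (Δ ++ Y) q σ₁)) ∙ invW-cancelˡ Δ² (σ₁⁻¹ ∷ q))

σ₂⁻¹≈Δ⁻²YΔ : ∀ q → (σ₂⁻¹ ∷ q) ≈B (Δ⁻² ++ Y ++ Δ ++ q)
σ₂⁻¹≈Δ⁻²YΔ q =
  ≈sym (≈B-congˡ Δ⁻² (≈sym (braid Δ (σ₂⁻¹ ∷ q) ∙ cancel (Δ ++ σ₂ ∷ σ₁ ∷ []) q σ₂))
        ∙ invW-cancelˡ Δ² (σ₂⁻¹ ∷ q))

data Syllable : Set where
  δ υ υ⁻¹ : Syllable

syllable : Syllable → Word
syllable δ = Δ
syllable υ = Y
syllable υ⁻¹ = Y⁻¹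

syllables : List Syllable → Word
syllables = concatMap syllable

data IsY : Syllable → Set where
  isY-υ : IsY υ
  isY-υ⁻¹ : IsY υ⁻¹

data Alternate : Syllable → Syllable → Set where
  δ-υ : Alternate δ υ
  δ-υ⁻¹ : Alternate δ υ⁻¹
  υ-δ : Alternate υ δ
  υ⁻¹-δ : Alternate υ⁻¹ δ

Reduced : List Syllable → Set
Reduced = Linked Alternate

Δ²-power : ℕ → ℕ → Word
Δ²-power p m = Δ² ^ p ++ Δ⁻² ^ m

Δ²-power-central : ∀ p m → Central (Δ²-power p m)
Δ²-power-central p m = Central-++ (Central-^ p Δ²-central) (Central-^ m (Central-invW Δ²-central))

record NormalForm : Set where
  constructor nf
  field
    exp⁺ exp⁻ : ℕ
    alternating : List Syllable

open NormalForm

⟦_⟧ : NormalForm → Word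
⟦ nf p m r ⟧ = Δ²-power p m ++ syllables r

absorb-Δ² : ∀ p m w → (Δ²-power p m ++ Δ² ++ w) ≈B (Δ²-power (suc p) m ++ w)
absorb-Δ² p m w =
  Central-slide Δ²-central (Δ²-power p m) w
  ∙ ≡⇒≈B (trans (sym (++-assoc Δ² (Δ²-power p m) w)) (cong (_++ w) (sym (++-assoc Δ² (Δ² ^ p) (Δ⁻² ^ m)))))

absorb-Δ⁻² : ∀ p m w → (Δ²-power p m ++ Δ⁻² ++ w) ≈B (Δ²-power p (suc m) ++ w)
absorb-Δ⁻² p m w =
  ≡⇒≈B (++-assoc (Δ² ^ p) (Δ⁻² ^ m) (Δ⁻² ++ w))
  ∙ ≈B-congˡ (Δ² ^ p) (Central-slide (Central-invW Δ²-central) (Δ⁻² ^ m) w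
                       ∙ ≡⇒≈B (sym (++-assoc Δ⁻² (Δ⁻² ^ m) w)))
  ∙ ≡⇒≈B (sym (++-assoc (Δ² ^ p) (Δ⁻² ^ suc m) w))

push : Syllable → NormalForm → NormalForm
push δ (nf p m (δ ∷ r)) = nf (suc p) m r
push δ (nf p m r@[]) = nf p m (δ ∷ r)
push δ (nf p m r@(υ ∷ _)) = nf p m (δ ∷ r)
push δ (nf p m r@(υ⁻¹ ∷ _)) = nf p m (δ ∷ r)
push υ (nf p m (υ ∷ r)) = nf (suc p) m (υ⁻¹ ∷ r)
push υ (nf p m (υ⁻¹ ∷ r)) = nf p m r
push υ (nf p m r@[]) = nf p m (υ ∷ r)
push υ (nf p m r@(δ ∷ _)) = nf p m (υ ∷ r)
push υ⁻¹ (nf p m (υ⁻¹ ∷ r)) = nf p (suc m) (υ ∷ r)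
push υ⁻¹ (nf p m (υ ∷ r)) = nf p m r
push υ⁻¹ (nf p m r@[]) = nf p m (υ⁻¹ ∷ r)
push υ⁻¹ (nf p m r@(δ ∷ _)) = nf p m (υ⁻¹ ∷ r)

push-correct : ∀ s n → (syllable s ++ ⟦ n ⟧) ≈B ⟦ push s n ⟧
push-correct s (nf p m r) =
  Central-slide (Δ²-power-central p m) (syllable s) (syllables r) ∙ merge s r
  where
  merge : ∀ s r → (Δ²-power p m ++ syllable s ++ syllables r) ≈B ⟦ push s (nf p m r) ⟧
  merge δ (δ ∷ r) = absorb-Δ² p m (syllables r)
  merge δ [] = ≈refl
  merge δ (υ ∷ r) = ≈refl
  merge δ (υ⁻¹ ∷ r) = ≈refl
  merge υ (υ ∷ r) = ≈B-congˡ (Δ²-power p m) (Y²≈Δ²Y⁻¹ _) ∙ absorb-Δ² p m (syllables (υ⁻¹ ∷ r))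
  merge υ (υ⁻¹ ∷ r) = ≈B-congˡ (Δ²-power p m) (invW-cancelʳ Y (syllables r))
  merge υ [] = ≈refl
  merge υ (δ ∷ r) = ≈refl
  merge υ⁻¹ (υ⁻¹ ∷ r) = ≈B-congˡ (Δ²-power p m) (Y⁻²≈Δ⁻²Y _) ∙ absorb-Δ⁻² p m (syllables (υ ∷ r))
  merge υ⁻¹ (υ ∷ r) = ≈B-congˡ (Δ²-power p m) (invW-cancelˡ Y (syllables r))
  merge υ⁻¹ [] = ≈refl
  merge υ⁻¹ (δ ∷ r) = ≈refl

Reduced-swapY : ∀ {y y′ r} → IsY y → IsY y′ → Reduced (y ∷ r) → Reduced (y′ ∷ r)
Reduced-swapY _ _ [-] = [-]
Reduced-swapY _ isY-υ (υ-δ ∷ h) = υ-δ ∷ h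
Reduced-swapY _ isY-υ (υ⁻¹-δ ∷ h) = υ-δ ∷ h
Reduced-swapY _ isY-υ⁻¹ (υ-δ ∷ h) = υ⁻¹-δ ∷ h
Reduced-swapY _ isY-υ⁻¹ (υ⁻¹-δ ∷ h) = υ⁻¹-δ ∷ h
Reduced-swapY () _ (δ-υ ∷ h)
Reduced-swapY () _ (δ-υ⁻¹ ∷ h)

push-reduced : ∀ s n → Reduced (alternating n) → Reduced (alternating (push s n))
push-reduced δ (nf p m (δ ∷ r)) h = Linked.tail h
push-reduced δ (nf p m []) h = [-]
push-reduced δ (nf p m (υ ∷ r)) h = δ-υ ∷ h
push-reduced δ (nf p m (υ⁻¹ ∷ r)) h = δ-υ⁻¹ ∷ h
push-reduced υ (nf p m (υ ∷ r)) h = Reduced-swapY isY-υ isY-υ⁻¹ h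
push-reduced υ (nf p m (υ⁻¹ ∷ r)) h = Linked.tail h
push-reduced υ (nf p m []) h = [-]
push-reduced υ (nf p m (δ ∷ r)) h = υ-δ ∷ h
push-reduced υ⁻¹ (nf p m (υ⁻¹ ∷ r)) h = Reduced-swapY isY-υ⁻¹ isY-υ h
push-reduced υ⁻¹ (nf p m (υ ∷ r)) h = Linked.tail h
push-reduced υ⁻¹ (nf p m []) h = [-]
push-reduced υ⁻¹ (nf p m (δ ∷ r)) h = υ⁻¹-δ ∷ h

push-Δ⁻² : NormalForm → NormalForm
push-Δ⁻² (nf p m r) = nf p (suc m) r

push-Δ⁻²-correct : ∀ n → (Δ⁻² ++ ⟦ n ⟧) ≈B ⟦ push-Δ⁻² n ⟧
push-Δ⁻²-correct (nf p m r) =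
  Central-slide (Δ²-power-central p m) Δ⁻² (syllables r) ∙ absorb-Δ⁻² p m (syllables r)

act : Letter → NormalForm → NormalForm
act σ₁ n = push υ⁻¹ (push δ n)
act σ₂ n = push δ (push υ⁻¹ n)
act σ₁⁻¹ n = push-Δ⁻² (push δ (push υ n))
act σ₂⁻¹ n = push-Δ⁻² (push υ (push δ n))

act-correct : ∀ x n → (x ∷ ⟦ n ⟧) ≈B ⟦ act x n ⟧
act-correct σ₁ n =
  σ₁≈Y⁻¹Δ ⟦ n ⟧ ∙ ≈B-congˡ Y⁻¹ (push-correct δ n) ∙ push-correct υ⁻¹ (push δ n)
act-correct σ₂ n =
  σ₂≈ΔY⁻¹ ⟦ n ⟧ ∙ ≈B-congˡ Δ (push-correct υ⁻¹ n) ∙ push-correct δ (push υ⁻¹ n)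
act-correct σ₁⁻¹ n =
  σ₁⁻¹≈Δ⁻²ΔY ⟦ n ⟧
  ∙ ≈B-congˡ Δ⁻² (≈B-congˡ Δ (push-correct υ n) ∙ push-correct δ (push υ n))
  ∙ push-Δ⁻²-correct (push δ (push υ n))
act-correct σ₂⁻¹ n =
  σ₂⁻¹≈Δ⁻²YΔ ⟦ n ⟧
  ∙ ≈B-congˡ Δ⁻² (≈B-congˡ Y (push-correct δ n) ∙ push-correct υ (push δ n))
  ∙ push-Δ⁻²-correct (push υ (push δ n))

act-reduced : ∀ x n → Reduced (alternating n) → Reduced (alternating (act x n))
act-reduced σ₁ n h = push-reduced υ⁻¹ (push δ n) (push-reduced δ n h)
act-reduced σ₂ n h = push-reduced δ (push υ⁻¹ n) (push-reduced υ⁻¹ n h)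
act-reduced σ₁⁻¹ n h = push-reduced δ (push υ n) (push-reduced υ n h)
act-reduced σ₂⁻¹ n h = push-reduced υ (push δ n) (push-reduced δ n h)

normalForm : Word → NormalForm
normalForm = foldr act (nf 0 0 [])

normalForm-correct : ∀ w → w ≈B ⟦ normalForm w ⟧
normalForm-correct [] = ≈refl
normalForm-correct (x ∷ w) = ≈B-congˡ [ x ] (normalForm-correct w) ∙ act-correct x (normalForm w)

normalForm-reduced : ∀ w → Reduced (alternating (normalForm w))
normalForm-reduced [] = []
normalForm-reduced (x ∷ w) = act-reduced x (normalForm w) (normalForm-reduced w)

-- Ping-pong

X : Mat
X = φ Δ

data Mixed : Mat → Set where
  mixed : ∀ a b c d → 3 ≤ a ℕ.+ b ℕ.+ c ℕ.+ d → Mixed (mat (+ a) (- + b) (- + c) (+ d))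

Mixed± : Mat → Set
Mixed± M = Mixed M ⊎ Mixed (-I₂ ⊗ M)

U L : Mat
U = mat (+ 1) (- + 1) (+ 0) (+ 1)
L = mat (+ 1) (+ 0) (- + 1) (+ 1)

Mixed-U⊗ : ∀ {M} → Mixed M → Mixed (U ⊗ M)
Mixed-U⊗ (mixed a b c d h) =
  subst Mixed (sym (mat-cong (e₁ (+ a) (+ c)) (e₂ (+ b) (+ d)) (e₃ (+ a) (+ c)) (e₄ (+ b) (+ d))))
        (mixed (a ℕ.+ c) (b ℕ.+ d) c d (ℕP.≤-trans h larger))
  where
  e₁ : ∀ x y → + 1 * x + - + 1 * (- y) ≡ x + y
  e₁ = solve-∀
  e₂ : ∀ x y → + 1 * (- x) + - + 1 * y ≡ - (x + y)
  e₂ = solve-∀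
  e₃ : ∀ x y → + 0 * x + + 1 * (- y) ≡ - y
  e₃ = solve-∀
  e₄ : ∀ x y → + 0 * (- x) + + 1 * y ≡ y
  e₄ = solve-∀
  larger : a ℕ.+ b ℕ.+ c ℕ.+ d ℕ.≤ a ℕ.+ c ℕ.+ (b ℕ.+ d) ℕ.+ c ℕ.+ d
  larger = ℕP.+-monoˡ-≤ d (ℕP.+-monoˡ-≤ c (ℕP.+-mono-≤ (ℕP.m≤m+n a c) (ℕP.m≤m+n b d)))

Mixed-L⊗ : ∀ {M} → Mixed M → Mixed (L ⊗ M)
Mixed-L⊗ (mixed a b c d h) =
  subst Mixed (sym (mat-cong (e₁ (+ a) (+ c)) (e₂ (+ b) (+ d)) (e₃ (+ a) (+ c)) (e₄ (+ b) (+ d))))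
        (mixed a b (a ℕ.+ c) (b ℕ.+ d) (ℕP.≤-trans h larger))
  where
  e₁ : ∀ x y → + 1 * x + + 0 * (- y) ≡ x
  e₁ = solve-∀
  e₂ : ∀ x y → + 1 * (- x) + + 0 * y ≡ - x
  e₂ = solve-∀
  e₃ : ∀ x y → - + 1 * x + + 1 * (- y) ≡ - (x + y)
  e₃ = solve-∀
  e₄ : ∀ x y → - + 1 * (- x) + + 1 * y ≡ x + y
  e₄ = solve-∀
  larger : a ℕ.+ b ℕ.+ c ℕ.+ d ℕ.≤ a ℕ.+ b ℕ.+ (a ℕ.+ c) ℕ.+ (b ℕ.+ d)
  larger = ℕP.+-mono-≤ (ℕP.+-monoʳ-≤ (a ℕ.+ b) (ℕP.m≤n+m c a)) (ℕP.m≤n+m d b)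

Mixed±-⊗ : ∀ {A M} → (∀ {N} → Mixed N → Mixed (A ⊗ N)) → Mixed± M → Mixed± (A ⊗ M)
Mixed±-⊗ A-step (inj₁ m) = inj₁ (A-step m)
Mixed±-⊗ {A} {M} A-step (inj₂ m) = inj₂ (subst Mixed (-I₂-commutes A M) (A-step m))

Mixed±-neg : ∀ {M} → Mixed± M → Mixed± (-I₂ ⊗ M)
Mixed±-neg {M} (inj₁ m) = inj₂ (subst Mixed (sym (-I₂-involutive M)) m)
Mixed±-neg (inj₂ m) = inj₁ m

Mixed±-XY : ∀ {y} → IsY y → Mixed± (X ⊗ φ (syllable y))
Mixed±-XY isY-υ = inj₂ (mixed 1 1 0 1 (s≤s (s≤s (s≤s z≤n))))
Mixed±-XY isY-υ⁻¹ = inj₁ (mixed 1 0 1 1 (s≤s (s≤s (s≤s z≤n))))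

-- X φ(Y) = −U and X φ(Y⁻¹) = L hold definitionally.
Mixed±-XY⊗ : ∀ {y M} → IsY y → Mixed± M → Mixed± ((X ⊗ φ (syllable y)) ⊗ M)
Mixed±-XY⊗ {M = M} isY-υ m =
  subst Mixed± (sym (⊗-assoc -I₂ U M)) (Mixed±-neg (Mixed±-⊗ {U} Mixed-U⊗ m))
Mixed±-XY⊗ isY-υ⁻¹ m = Mixed±-⊗ {L} Mixed-L⊗ m

MixedUpToX : Mat → Set
MixedUpToX Q = ∃ λ M → Mixed± M × (Q ≡ M ⊎ Q ≡ M ⊗ X)

MixedUpToX-⊗ : ∀ {A Q} → (∀ {M} → Mixed± M → Mixed± (A ⊗ M)) → MixedUpToX Q → MixedUpToX (A ⊗ Q)
MixedUpToX-⊗ {A} A-step (M , m , inj₁ Q≡M) = A ⊗ M , A-step m , inj₁ (cong (A ⊗_) Q≡M)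
MixedUpToX-⊗ {A} A-step (M , m , inj₂ Q≡MX) =
  A ⊗ M , A-step m , inj₂ (trans (cong (A ⊗_) Q≡MX) (sym (⊗-assoc A M X)))

Alternate-δ⇒IsY : ∀ {y} → Alternate δ y → IsY y
Alternate-δ⇒IsY δ-υ = isY-υ
Alternate-δ⇒IsY δ-υ⁻¹ = isY-υ⁻¹

ping-pong : ∀ {y r} → IsY y → Reduced (y ∷ r) → MixedUpToX (X ⊗ φ (syllables (y ∷ r)))
ping-pong isY-υ [-] = _ , Mixed±-XY isY-υ , inj₁ refl
ping-pong isY-υ⁻¹ [-] = _ , Mixed±-XY isY-υ⁻¹ , inj₁ refl
ping-pong isY-υ (υ-δ ∷ [-]) = _ , Mixed±-XY isY-υ , inj₂ refl
ping-pong isY-υ⁻¹ (υ⁻¹-δ ∷ [-]) = _ , Mixed±-XY isY-υ⁻¹ , inj₂ refl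
ping-pong {y} {δ ∷ r} y-isY (_ ∷ δ-y′ ∷ h) =
  subst MixedUpToX (sym (split (syllable y) (syllables r)))
        (MixedUpToX-⊗ {X ⊗ φ (syllable y)} (Mixed±-XY⊗ y-isY) (ping-pong (Alternate-δ⇒IsY δ-y′) h))
  where
  split : ∀ a w → X ⊗ φ (a ++ Δ ++ w) ≡ (X ⊗ φ a) ⊗ (X ⊗ φ w)
  split a w = begin
    X ⊗ φ (a ++ Δ ++ w)    ≡⟨ cong (X ⊗_) (trans (φ-++ a (Δ ++ w)) (cong (φ a ⊗_) (φ-++ Δ w))) ⟩
    X ⊗ (φ a ⊗ (X ⊗ φ w))  ≡⟨ ⊗-assoc X (φ a) (X ⊗ φ w) ⟨
    (X ⊗ φ a) ⊗ (X ⊗ φ w)  ∎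
    where open ≡-Reasoning

data XPower : Mat → Set where
  X⁰ : XPower I₂
  X¹ : XPower X
  X² : XPower -I₂
  X³ : XPower (-I₂ ⊗ X)

XPower-X⊗ : ∀ {Q} → XPower Q → XPower (X ⊗ Q)
XPower-X⊗ X⁰ = X¹
XPower-X⊗ X¹ = X²
XPower-X⊗ X² = X³
XPower-X⊗ X³ = X⁰

XPower-⊗X⁻¹ : ∀ {Q} → XPower Q → XPower (Q ⊗ invSL X)
XPower-⊗X⁻¹ X⁰ = X³
XPower-⊗X⁻¹ X¹ = X⁰
XPower-⊗X⁻¹ X² = X¹
XPower-⊗X⁻¹ X³ = X²

XPower-neg : ∀ {Q} → XPower Q → XPower (-I₂ ⊗ Q)
XPower-neg X⁰ = X²
XPower-neg X¹ = X³
XPower-neg X² = X⁰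
XPower-neg X³ = X¹

absSum : Mat → ℕ
absSum (mat a b c d) = ∣ a ∣ ℕ.+ ∣ b ∣ ℕ.+ ∣ c ∣ ℕ.+ ∣ d ∣

XPower-absSum : ∀ {Q} → XPower Q → absSum Q ≡ 2
XPower-absSum X⁰ = refl
XPower-absSum X¹ = refl
XPower-absSum X² = refl
XPower-absSum X³ = refl

Mixed-absSum : ∀ {M} → Mixed M → 3 ≤ absSum M
Mixed-absSum (mixed a b c d h) rewrite ℤ.∣-i∣≡∣i∣ (+ b) | ℤ.∣-i∣≡∣i∣ (+ c) = h

Mixed⇒¬XPower : ∀ {M} → Mixed M → ¬ XPower M
Mixed⇒¬XPower m x with subst (3 ≤_) (XPower-absSum x) (Mixed-absSum m)
... | s≤s (s≤s ())

Mixed±⇒¬XPower : ∀ {M} → Mixed± M → ¬ XPower M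
Mixed±⇒¬XPower (inj₁ m) x = Mixed⇒¬XPower m x
Mixed±⇒¬XPower (inj₂ m) x = Mixed⇒¬XPower m (XPower-neg x)

MixedUpToX⇒¬XPower : ∀ {Q} → MixedUpToX Q → ¬ XPower Q
MixedUpToX⇒¬XPower (M , m , inj₁ Q≡M) x = Mixed±⇒¬XPower m (subst XPower Q≡M x)
MixedUpToX⇒¬XPower {Q} (M , m , inj₂ Q≡MX) x =
  Mixed±⇒¬XPower m (subst XPower M≡QX⁻¹ (XPower-⊗X⁻¹ x))
  where
  M≡QX⁻¹ : Q ⊗ invSL X ≡ M
  M≡QX⁻¹ = begin
    Q ⊗ invSL X          ≡⟨ cong (_⊗ invSL X) Q≡MX ⟩
    (M ⊗ X) ⊗ invSL X    ≡⟨ ⊗-assoc M X (invSL X) ⟩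
    M ⊗ (X ⊗ invSL X)    ≡⟨ ⊗-identityʳ M ⟩
    M                    ∎
    where open ≡-Reasoning

±I : Mat → Set
±I S = S ≡ I₂ ⊎ S ≡ -I₂

±I⇒XPower : ∀ {S} → ±I S → XPower S
±I⇒XPower (inj₁ refl) = X⁰
±I⇒XPower (inj₂ refl) = X²

reduced-±I⇒[] : ∀ r → Reduced r → ±I (φ (syllables r)) → r ≡ []
reduced-±I⇒[] [] _ _ = refl
reduced-±I⇒[] (δ ∷ []) _ (inj₁ ())
reduced-±I⇒[] (δ ∷ []) _ (inj₂ ())
reduced-±I⇒[] (δ ∷ y ∷ r) (δ-y ∷ h) ±I-image =
  ⊥-elim (MixedUpToX⇒¬XPower (ping-pong (Alternate-δ⇒IsY δ-y) h)
                              (subst XPower (φ-++ Δ (syllables (y ∷ r))) (±I⇒XPower ±I-image)))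
reduced-±I⇒[] (υ ∷ r) h ±I-image =
  ⊥-elim (MixedUpToX⇒¬XPower (ping-pong isY-υ h) (XPower-X⊗ (±I⇒XPower ±I-image)))
reduced-±I⇒[] (υ⁻¹ ∷ r) h ±I-image =
  ⊥-elim (MixedUpToX⇒¬XPower (ping-pong isY-υ⁻¹ h) (XPower-X⊗ (±I⇒XPower ±I-image)))

-- The kernel of φ

φ-Δ²-power : ∀ p m → φ (Δ²-power p m) ≡ -I₂ ^ᴹ (p ℕ.+ m)
φ-Δ²-power p m =
  trans (φ-++ (Δ² ^ p) (Δ⁻² ^ m)) (trans (cong₂ _⊗_ (φ-^ Δ² p) (φ-^ Δ⁻² m)) (^ᴹ-+ -I₂ p m))

-I₂^ᴹ-±I : ∀ k → ±I (-I₂ ^ᴹ k)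
-I₂^ᴹ-±I zero = inj₁ refl
-I₂^ᴹ-±I (suc k) with -I₂^ᴹ-±I k
... | inj₁ eq = inj₂ (trans (cong (-I₂ ⊗_) eq) (⊗-identityʳ -I₂))
... | inj₂ eq = inj₁ (cong (-I₂ ⊗_) eq)

±I-cancelˡ : ∀ {S A} → ±I S → S ⊗ A ≡ I₂ → ±I A
±I-cancelˡ {A = A} (inj₁ refl) SA≡I₂ = inj₁ (trans (sym (⊗-identityˡ A)) SA≡I₂)
±I-cancelˡ {A = A} (inj₂ refl) SA≡I₂ =
  inj₂ (trans (sym (-I₂-involutive A)) (cong (-I₂ ⊗_) SA≡I₂))

-I₂^ᴹ≡I₂⇒even : ∀ k → -I₂ ^ᴹ k ≡ I₂ → ∃ λ j → k ≡ j ℕ.+ j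
-I₂^ᴹ≡I₂⇒even zero _ = 0 , refl
-I₂^ᴹ≡I₂⇒even (suc zero) ()
-I₂^ᴹ≡I₂⇒even (suc (suc k)) eq with -I₂^ᴹ≡I₂⇒even k (trans (sym (-I₂-involutive (-I₂ ^ᴹ k))) eq)
... | j , k≡j+j = suc j , cong suc (trans (cong suc k≡j+j) (sym (ℕP.+-suc j j)))

normalForm-ker : ∀ n → Reduced (alternating n) → φ ⟦ n ⟧ ≡ I₂ →
                 alternating n ≡ [] × ∃ λ j → exp⁺ n ℕ.+ exp⁻ n ≡ j ℕ.+ j
normalForm-ker (nf p m r) r-reduced φn≡I₂ = r≡[] , -I₂^ᴹ≡I₂⇒even (p ℕ.+ m) power-trivial
  where
  split : -I₂ ^ᴹ (p ℕ.+ m) ⊗ φ (syllables r) ≡ I₂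
  split = trans (cong (_⊗ φ (syllables r)) (sym (φ-Δ²-power p m)))
                (trans (sym (φ-++ (Δ²-power p m) (syllables r))) φn≡I₂)
  r≡[] : r ≡ []
  r≡[] = reduced-±I⇒[] r r-reduced (±I-cancelˡ (-I₂^ᴹ-±I (p ℕ.+ m)) split)
  power-trivial : -I₂ ^ᴹ (p ℕ.+ m) ≡ I₂
  power-trivial =
    trans (sym (⊗-identityʳ _)) (subst (λ r → -I₂ ^ᴹ (p ℕ.+ m) ⊗ φ (syllables r) ≡ I₂) r≡[] split)

ker-φ : ∀ w → φ w ≡ I₂ → ∃ λ p → ∃ λ m → w ≈B Δ²-power p m × ∃ λ j → p ℕ.+ m ≡ j ℕ.+ j
ker-φ w φw≡I₂ with normalForm w | normalForm-correct w | normalForm-reduced w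
... | nf p m r | w≈n | r-reduced
    with normalForm-ker (nf p m r) r-reduced (trans (sym (φ-resp-≈B w≈n)) φw≡I₂)
... | refl , even = p , m , (w≈n ∙ ≡⇒≈B (++-identityʳ (Δ²-power p m))) , even

ε-Δ²-power : ∀ p m → ε (Δ²-power p m) ≡ (+ p - + m) * + 6
ε-Δ²-power p m =
  trans (ε-++ (Δ² ^ p) (Δ⁻² ^ m)) (trans (cong₂ _+_ (ε-^ Δ² p) (ε-^ Δ⁻² m)) (collect (+ p) (+ m)))
  where
  collect : ∀ p m → p * + 6 + m * - + 6 ≡ (p - m) * + 6
  collect = solve-∀

Δ²-power-cancel : ∀ p → Δ²-power p p ≈B []
Δ²-power-cancel zero = ≈refl
Δ²-power-cancel (suc p) = begin
  (Δ² ++ Δ² ^ p) ++ Δ⁻² ++ Δ⁻² ^ p    ≡⟨ ++-assoc Δ² (Δ² ^ p) (Δ⁻² ++ Δ⁻² ^ p) ⟩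
  Δ² ++ Δ² ^ p ++ Δ⁻² ++ Δ⁻² ^ p      ≈⟨ ≈B-congˡ Δ² (Central-slide (Central-invW Δ²-central) (Δ² ^ p) (Δ⁻² ^ p)) ⟩
  Δ² ++ Δ⁻² ++ Δ² ^ p ++ Δ⁻² ^ p      ≡⟨ cong (λ w → Δ² ++ Δ⁻² ++ w) (sym (++-identityʳ (Δ²-power p p))) ⟩
  Δ² ++ Δ⁻² ++ Δ²-power p p ++ []      ≈⟨ invW-cancelʳ Δ² _ ⟩
  Δ²-power p p ++ []                   ≈⟨ ≈B-congʳ [] (Δ²-power-cancel p) ⟩
  []                                  ∎
  where open ≈B-Reasoning

even-sum⇒6[p-m]≡12k : ∀ p m j → p + m ≡ j + j → (p - m) * + 6 ≡ (j - m) * + 12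
even-sum⇒6[p-m]≡12k p m j p+m≡j+j = begin
  (p - m) * + 6                 ≡⟨ rearrange p m ⟩
  ((p + m) - (m + m)) * + 6     ≡⟨ cong (λ s → (s - (m + m)) * + 6) p+m≡j+j ⟩
  ((j + j) - (m + m)) * + 6     ≡⟨ double j m ⟩
  (j - m) * + 12                ∎
  where
  open ≡-Reasoning
  rearrange : ∀ p m → (p - m) * + 6 ≡ ((p + m) - (m + m)) * + 6
  rearrange = solve-∀
  double : ∀ j m → ((j + j) - (m + m)) * + 6 ≡ (j - m) * + 12
  double = solve-∀

ker-φ⇒12∣ε : ∀ w → φ w ≡ I₂ → ∃ λ k → ε w ≡ k * + 12
ker-φ⇒12∣ε w φw≡I₂ with ker-φ w φw≡I₂
... | p , m , w≈Δ²-power , j , p+m≡j+j =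
  + j - + m ,
  trans (ε-resp-≈B w≈Δ²-power)
        (trans (ε-Δ²-power p m) (even-sum⇒6[p-m]≡12k (+ p) (+ m) (+ j) (cong +_ p+m≡j+j)))

ε-Δ²-power≡0⇒≡ : ∀ p m → ε (Δ²-power p m) ≡ + 0 → p ≡ m
ε-Δ²-power≡0⇒≡ p m ε≡0 =
  ℤ.+-injective (ℤ.i-j≡0⇒i≡j (+ p) (+ m)
    (ℤ.*-cancelʳ-≡ (+ p - + m) (+ 0) (+ 6) (trans (sym (ε-Δ²-power p m)) ε≡0)))

ker-φ-ε≡0 : ∀ w → φ w ≡ I₂ → ε w ≡ + 0 → w ≈B []
ker-φ-ε≡0 w φw≡I₂ εw≡0 with ker-φ w φw≡I₂
... | p , m , w≈Δ²-power , _ with ε-Δ²-power≡0⇒≡ p m (trans (sym (ε-resp-≈B w≈Δ²-power)) εw≡0)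
... | refl = w≈Δ²-power ∙ Δ²-power-cancel p

φ-quotient≡I₂ : ∀ v v′ → φ v ≡ φ v′ → φ (v ++ invW v′) ≡ I₂
φ-quotient≡I₂ v v′ φv≡φv′ =
  trans (φ-++ v (invW v′)) (trans (cong₂ _⊗_ φv≡φv′ (φ-invW v′)) (⊗-invSLʳ (φ v′) (φ-InSL v′)))

ε-quotient : ∀ v v′ → ε (v ++ invW v′) ≡ ε v - ε v′
ε-quotient v v′ = trans (ε-++ v (invW v′)) (cong (λ k → ε v + k) (ε-invW v′))

φ×ε-injective : ∀ v v′ → φ v ≡ φ v′ → ε v ≡ ε v′ → v ≈B v′
φ×ε-injective v v′ φv≡φv′ εv≡εv′ = begin
  v                          ≡⟨ ++-identityʳ v ⟨
  v ++ []                    ≈⟨ ≈B-congˡ v (invW-cancelˡ v′ []) ⟨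
  v ++ invW v′ ++ v′ ++ []   ≡⟨ ++-assoc v (invW v′) (v′ ++ []) ⟨
  (v ++ invW v′) ++ v′ ++ [] ≈⟨ ≈B-congʳ (v′ ++ []) (ker-φ-ε≡0 (v ++ invW v′) (φ-quotient≡I₂ v v′ φv≡φv′) quotient-ε≡0) ⟩
  v′ ++ []                   ≡⟨ ++-identityʳ v′ ⟩
  v′                         ∎
  where
  open ≈B-Reasoning
  quotient-ε≡0 : ε (v ++ invW v′) ≡ + 0
  quotient-ε≡0 = trans (ε-quotient v v′) (trans (cong (_- ε v′) εv≡εv′) (ℤ.+-inverseʳ (ε v′)))

φ-≡⇒ε-≡-mod-12 : ∀ v v′ → φ v ≡ φ v′ → ∃ λ k → ε v - ε v′ ≡ k * + 12
φ-≡⇒ε-≡-mod-12 v v′ φv≡φv′ =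
  map₂ (trans (sym (ε-quotient v v′))) (ker-φ⇒12∣ε (v ++ invW v′) (φ-quotient≡I₂ v v′ φv≡φv′))

-- Surjectivity of φ

*≡1⇒±1 : ∀ a d → a * d ≡ + 1 → (a ≡ + 1 × d ≡ + 1) ⊎ (a ≡ - + 1 × d ≡ - + 1)
*≡1⇒±1 a d ad≡1 =
  by-cases a (ℕP.m*n≡1⇒m≡1 ∣ a ∣ ∣ d ∣ (trans (sym (ℤ.∣i*j∣≡∣i∣*∣j∣ a d)) (cong ∣_∣ ad≡1))) ad≡1
  where
  by-cases : ∀ a → ∣ a ∣ ≡ 1 → a * d ≡ + 1 → (a ≡ + 1 × d ≡ + 1) ⊎ (a ≡ - + 1 × d ≡ - + 1)
  by-cases (+ 1) _ ad≡1 = inj₁ (refl , trans (sym (ℤ.*-identityˡ d)) ad≡1)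
  by-cases -[1+ 0 ] _ ad≡1 =
    inj₂ (refl , trans (sym (ℤ.neg-involutive d)) (cong -_ (trans (sym (ℤ.-1*i≡-i d)) ad≡1)))
  by-cases (+ 0) () _
  by-cases (+ suc (suc _)) () _
  by-cases -[1+ suc _ ] () _

euclid-lowerLeft : ∀ a b c d q r → a ≡ r + q * c → Mat.c (X ⊗ (T (- q) ⊗ mat a b c d)) ≡ - r
euclid-lowerLeft _ b c d q r refl = expand q c r
  where
  expand : ∀ q c r → - + 1 * (+ 1 * (r + q * c) + (- q) * c) + + 0 * (+ 0 * (r + q * c) + + 1 * c) ≡ - r
  expand = solve-∀

euclid-undo : ∀ q M → T q ⊗ (invSL X ⊗ (X ⊗ (T (- q) ⊗ M))) ≡ M
euclid-undo q M = begin
  T q ⊗ (invSL X ⊗ (X ⊗ N))  ≡⟨ cong (T q ⊗_) (⊗-assoc (invSL X) X N) ⟨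
  T q ⊗ ((invSL X ⊗ X) ⊗ N)  ≡⟨ cong (T q ⊗_) (⊗-identityˡ N) ⟩
  T q ⊗ (T (- q) ⊗ M)        ≡⟨ ⊗-assoc (T q) (T (- q)) M ⟨
  (T q ⊗ T (- q)) ⊗ M        ≡⟨ cong (_⊗ M) (trans (T-+ q (- q)) (cong T (ℤ.+-inverseʳ q))) ⟩
  I₂ ⊗ M                     ≡⟨ ⊗-identityˡ M ⟩
  M                          ∎
  where
  open ≡-Reasoning
  N = T (- q) ⊗ M

Preimage : Mat → Set
Preimage M = ∃ λ w → φ w ≡ M

φ-surjective : ∀ M → InSL M → Preimage M
φ-surjective M = <-rec Goal reduce ∣ Mat.c M ∣ M refl
  where
  Goal : ℕ → Set
  Goal n = ∀ M → ∣ Mat.c M ∣ ≡ n → InSL M → Preimage M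

  euclid : ∀ a b c d .{{_ : NonZero c}} → (∀ {m} → m ℕ.< ∣ c ∣ → Goal m) →
           InSL (mat a b c d) → Preimage (mat a b c d)
  euclid a b c d smaller detM≡1 = undo (smaller lt M′ refl M′-InSL)
    where
    q : ℤ
    q = a / c
    M′ : Mat
    M′ = X ⊗ (T (- q) ⊗ mat a b c d)
    M′-InSL : InSL M′
    M′-InSL = InSL-⊗ X (T (- q) ⊗ mat a b c d) refl (InSL-⊗ (T (- q)) (mat a b c d) (T-InSL (- q)) detM≡1)
    lt : ∣ Mat.c M′ ∣ ℕ.< ∣ c ∣
    lt = subst (ℕ._< ∣ c ∣)
               (sym (trans (cong ∣_∣ (euclid-lowerLeft a b c d q (+ (a %ℤ c)) (a≡a%n+[a/n]*n a c)))
                           (ℤ.∣-i∣≡∣i∣ (+ (a %ℤ c)))))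
               (n%d<d a c)
    undo : Preimage M′ → Preimage (mat a b c d)
    undo (w′ , φw′≡M′) =
      [ σ₁ ] ^ℤ q ++ invW Δ ++ w′ ,
      trans (φ-++ ([ σ₁ ] ^ℤ q) (invW Δ ++ w′))
            (trans (cong₂ _⊗_ (φ-σ₁^ℤ q) (trans (φ-++ (invW Δ) w′) (cong (invSL X ⊗_) φw′≡M′)))
                   (euclid-undo q (mat a b c d)))

  triangular : ∀ a b d → a * d ≡ + 1 → Preimage (mat a b (+ 0) d)
  triangular a b d ad≡1 with *≡1⇒±1 a d ad≡1
  ... | inj₁ (refl , refl) = [ σ₁ ] ^ℤ b , φ-σ₁^ℤ b
  ... | inj₂ (refl , refl) =
    Δ² ++ [ σ₁ ] ^ℤ (- b) ,
    trans (φ-++ Δ² ([ σ₁ ] ^ℤ (- b))) (trans (cong (-I₂ ⊗_) (φ-σ₁^ℤ (- b))) (mat-cong refl (negate b) refl refl))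
    where
    negate : ∀ b → - + 1 * (- b) + + 0 * + 1 ≡ b
    negate = solve-∀

  reduce : ∀ n → (∀ {m} → m ℕ.< n → Goal m) → Goal n
  reduce _ _ (mat a b (+ 0) d) _ detM≡1 = triangular a b d (trans (expand a b d) detM≡1)
    where
    expand : ∀ a b d → a * d ≡ a * d - b * + 0
    expand = solve-∀
  reduce _ smaller (mat a b c@(+ suc _) d) refl = euclid a b c d smaller
  reduce _ smaller (mat a b c@(-[1+ _ ]) d) refl = euclid a b c d smaller

-- Conjugacy classes

ConjB⇒ConjSL : ∀ {w w′} → ConjB w w′ → ConjSL (φ w) (φ w′)
ConjB⇒ConjSL {w} (u , uwu⁻¹≈w′) = φ u , φ-InSL u , trans (sym (φ-conj u w)) (φ-resp-≈B uwu⁻¹≈w′)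

ConjSL-lift : ∀ w {A} → ConjSL (φ w) A → ∃ λ u → φ (u ++ w ++ invW u) ≡ A
ConjSL-lift w {A} (P , P-InSL , PφwP⁻¹≡A) = lift (φ-surjective P P-InSL)
  where
  lift : Preimage P → ∃ λ u → φ (u ++ w ++ invW u) ≡ A
  lift (u , φu≡P) = u , trans (φ-conj u w) (trans (cong (λ Q → (Q ⊗ φ w) ⊗ invSL Q) φu≡P) PφwP⁻¹≡A)

ConjSL⇒ConjB : ∀ w w′ → ConjSL (φ w) (φ w′) → ε w ≡ ε w′ → ConjB w w′
ConjSL⇒ConjB w w′ φw∼φw′ εw≡εw′ =
  let u , φ-lift = ConjSL-lift w φw∼φw′
  in u , φ×ε-injective (u ++ w ++ invW u) w′ φ-lift (trans (ε-conj u w) εw≡εw′)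

ConjSL⇒ε≡-mod-12 : ∀ w w′ → ConjSL (φ w) (φ w′) → ∃ λ k → ε w - ε w′ ≡ k * + 12
ConjSL⇒ε≡-mod-12 w w′ φw∼φw′ =
  let u , φ-lift = ConjSL-lift w φw∼φw′
  in subst (λ e → ∃ λ k → e - ε w′ ≡ k * + 12) (ε-conj u w)
           (φ-≡⇒ε-≡-mod-12 (u ++ w ++ invW u) w′ φ-lift)

+-minus-cancel : ∀ n k → n + k - k ≡ n
+-minus-cancel = solve-∀

residue-uniqueℕ : ∀ {i j} k → i ℕ.< 12 → j ℕ.< 12 → i ≡ j ℕ.+ k ℕ.* 12 → i ≡ j
residue-uniqueℕ {i} {j} k i<12 j<12 i≡j+12k = begin
  i                   ≡⟨ m≤n⇒m%n≡m (ℕ.s≤s⁻¹ i<12) ⟨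
  i % 12              ≡⟨ cong (_% 12) i≡j+12k ⟩
  (j ℕ.+ k ℕ.* 12) % 12 ≡⟨ [m+kn]%n≡m%n j k 12 ⟩
  j % 12              ≡⟨ m≤n⇒m%n≡m (ℕ.s≤s⁻¹ j<12) ⟩
  j                   ∎
  where open ≡-Reasoning

residue-unique⁺ : ∀ {i j} k → i ℕ.< 12 → j ℕ.< 12 → + i - + j ≡ + k * + 12 → i ≡ j
residue-unique⁺ {i} {j} k i<12 j<12 i-j≡12k = residue-uniqueℕ k i<12 j<12 (ℤ.+-injective (begin
  + i                  ≡⟨ add-back (+ i) (+ j) ⟩
  + j + (+ i - + j)    ≡⟨ cong (λ d → + j + d) i-j≡12k ⟩
  + j + + k * + 12     ≡⟨ cong (λ d → + j + d) (ℤ.pos-* k 12) ⟨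
  + (j ℕ.+ k ℕ.* 12)   ∎))
  where
  open ≡-Reasoning
  add-back : ∀ x y → x ≡ y + (x - y)
  add-back = solve-∀

residue-unique : ∀ {i j} k → i ℕ.< 12 → j ℕ.< 12 → + i - + j ≡ k * + 12 → i ≡ j
residue-unique (+ k) i<12 j<12 = residue-unique⁺ k i<12 j<12
residue-unique {i} {j} -[1+ k ] i<12 j<12 i-j≡12k =
  sym (residue-unique⁺ (suc k) j<12 i<12 (trans (antisym (+ i) (+ j)) (trans (cong -_ i-j≡12k) (negate (+ suc k)))))
  where
  antisym : ∀ x y → y - x ≡ - (x - y)
  antisym = solve-∀
  negate : ∀ k → - ((- k) * + 12) ≡ k * + 12
  negate = solve-∀

φ-induces-injection : ∀ t n → InducesInjection (InX t n) ConjB (InY t) ConjSL φ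
φ-induces-injection t n =
  ((λ w (trw≡t , _) → φ-InSL w , trw≡t) , (λ _ _ _ _ → ConjB⇒ConjSL)) ,
  (λ w w′ (_ , εw≡n) (_ , εw′≡n) φw∼φw′ → ConjSL⇒ConjB w w′ φw∼φw′ (trans εw≡n (sym εw′≡n)))

Δ²-induces-bijection : ∀ t n → InducesBijection (InX t n) ConjB (InX (- t) (n + + 6)) ConjB (Δ² ++_)
Δ²-induces-bijection t n = central-translation-bijection Δ²-central forward backward
  where
  forward : ∀ w → InX t n w → InX (- t) (n + + 6) (Δ² ++ w)
  forward w (trw≡t , εw≡n) =
    trans (tr-flip Δ² w refl) (cong -_ trw≡t) , trans (ε-shift Δ² w) (cong (_+ + 6) εw≡n)
  backward : ∀ w → InX (- t) (n + + 6) w → InX t n (Δ⁻² ++ w)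
  backward w (trw≡-t , εw≡n+6) =
    trans (tr-flip Δ⁻² w refl) (trans (cong -_ trw≡-t) (ℤ.neg-involutive t)) ,
    trans (ε-unshift Δ² w) (trans (cong (_- + 6) εw≡n+6) (+-minus-cancel n (+ 6)))

-I₂-induces-bijection : ∀ t → InducesBijection (InY t) ConjSL (InY (- t)) ConjSL (-I₂ ⊗_)
-I₂-induces-bijection t =
  (negate , λ _ _ _ _ → ConjSL-neg) ,
  (λ A B _ _ −A∼−B → subst₂ ConjSL (-I₂-involutive A) (-I₂-involutive B) (ConjSL-neg −A∼−B)) ,
  λ B (detB≡1 , trB≡-t) → -I₂ ⊗ B ,
    (trans (det-neg B) detB≡1 , trans (trM-neg B) (trans (cong -_ trB≡-t) (ℤ.neg-involutive t))) ,
    ≡⇒ConjSL (-I₂-involutive B)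
  where
  negate : ∀ A → InY t A → InY (- t) (-I₂ ⊗ A)
  negate A (detA≡1 , trA≡t) = trans (det-neg A) detA≡1 , trans (trM-neg A) (cong -_ trA≡t)

Δ⁴-induces-bijection : ∀ t n → InducesBijection (InX t n) ConjB (InX t (n + + 12)) ConjB (Δ⁴ ++_)
Δ⁴-induces-bijection t n = central-translation-bijection Δ⁴-central forward backward
  where
  forward : ∀ w → InX t n w → InX t (n + + 12) (Δ⁴ ++ w)
  forward w (trw≡t , εw≡n) = trans (tr-shift Δ⁴ w refl) trw≡t , trans (ε-shift Δ⁴ w) (cong (_+ + 12) εw≡n)
  backward : ∀ w → InX t (n + + 12) w → InX t n (invW Δ⁴ ++ w)
  backward w (trw≡t , εw≡n+12) =
    trans (tr-shift (invW Δ⁴) w refl) trw≡t ,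
    trans (ε-unshift Δ⁴ w) (trans (cong (_- + 12) εw≡n+12) (+-minus-cancel n (+ 12)))

φ-induces-bijection-on-12-classes : ∀ t n → InducesBijection (InXU t n) ConjU (InY t) ConjSL φU
φ-induces-bijection-on-12-classes t n =
  ((λ (_ , w) (trw≡t , _) → φ-InSL w , trw≡t) , (λ _ _ _ _ (_ , w∼w′) → ConjB⇒ConjSL w∼w′)) ,
  injective , surjective
  where
  injective : InjectiveOn (InXU t n) ConjU (InY t) ConjSL φU
  injective (j , w) (j′ , w′) (_ , εw≡n+j) (_ , εw′≡n+j′) φw∼φw′ =
    j≡j′ ,
    ConjSL⇒ConjB w w′ φw∼φw′ (trans εw≡n+j (trans (cong (λ i → n + + toℕ i) j≡j′) (sym εw′≡n+j′)))
    where
    offsets : ∀ n a b → (n + a) - (n + b) ≡ a - b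
    offsets = solve-∀
    j≡j′ : j ≡ j′
    j≡j′ =
      let k , εw-εw′≡12k = ConjSL⇒ε≡-mod-12 w w′ φw∼φw′
      in toℕ-injective (residue-unique k (toℕ<n j) (toℕ<n j′)
           (trans (sym (offsets n (+ toℕ j) (+ toℕ j′)))
                  (trans (cong₂ _-_ (sym εw≡n+j) (sym εw′≡n+j′)) εw-εw′≡12k)))

  surjective : SurjectiveOn (InXU t n) ConjU (InY t) ConjSL φU
  surjective A (detA≡1 , trA≡t) = adjust (φ-surjective A detA≡1)
    where
    adjust : Preimage A → ∃ λ x → InXU t n x × ConjSL (φU x) A
    adjust (w₀ , φw₀≡A) = (j , w) , (trans (cong trM φw≡A) trA≡t , εw≡n+j) , ≡⇒ConjSL φw≡A
      where
      excess q : ℤ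
      excess = ε w₀ - n
      q = excess / + 12
      j : Fin 12
      j = fromℕ< (n%d<d excess (+ 12))
      w : Word
      w = Δ⁴ ^ℤ (- q) ++ w₀
      φw≡A : φ w ≡ A
      φw≡A = trans (φ-++ (Δ⁴ ^ℤ (- q)) w₀)
                   (trans (cong (_⊗ φ w₀) (φ-^ℤ-I₂ Δ⁴ (- q) refl)) (trans (⊗-identityˡ (φ w₀)) φw₀≡A))
      reduce : ∀ e n r q → e - n ≡ r + q * + 12 → (- q) * + 12 + e ≡ n + r
      reduce e n r q e-n≡ = trans (expand e n q) (trans (cong (λ x → n + (x - q * + 12)) e-n≡) (collapse n r q))
        where
        expand : ∀ e n q → (- q) * + 12 + e ≡ n + ((e - n) - q * + 12)
        expand = solve-∀
        collapse : ∀ n r q → n + ((r + q * + 12) - q * + 12) ≡ n + r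
        collapse = solve-∀
      εw≡n+j : ε w ≡ n + + toℕ j
      εw≡n+j = trans (ε-++ (Δ⁴ ^ℤ (- q)) w₀)
                 (trans (cong (_+ ε w₀) (ε-^ℤ Δ⁴ (- q)))
                   (trans (reduce (ε w₀) n (+ (excess %ℤ + 12)) q (a≡a%n+[a/n]*n excess (+ 12)))
                     (cong (λ i → n + + i) (sym (toℕ-fromℕ< (n%d<d excess (+ 12)))))))

lemma2p7 : ∀ (t n : ℤ) →
    -- (i)
    InducesInjection (InX t n) ConjB (InY t) ConjSL φ
    -- (ii)
    × InducesBijection (InX t n) ConjB (InX (- t) (n + + 6)) ConjB (Δ² ++_)
    × InducesBijection (InY t) ConjSL (InY (- t)) ConjSL (-I₂ ⊗_)
    × (∀ w → InX t n w → ConjSL (φ (Δ² ++ w)) (-I₂ ⊗ φ w))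
    -- (iii)
    × InducesBijection (InX t n) ConjB (InX t (n + + 12)) ConjB (Δ⁴ ++_)
    × (∀ w → InX t n w → ConjSL (φ (Δ⁴ ++ w)) (φ w))
    -- (iv)
    × InducesBijection (InXU t n) ConjU (InY t) ConjSL φU
lemma2p7 t n =
  φ-induces-injection t n ,
  Δ²-induces-bijection t n ,
  -I₂-induces-bijection t ,
  (λ w _ → ≡⇒ConjSL (φ-++ Δ² w)) ,
  Δ⁴-induces-bijection t n ,
  (λ w _ → ≡⇒ConjSL (trans (φ-++ Δ⁴ w) (⊗-identityˡ (φ w)))) ,
  φ-induces-bijection-on-12-classes t n
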